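{- For every integer $\gamma\ge 0$ there exists $g_0$ such that for every $g\ge g_0$ the following holds. Let $u_1=g-\gamma+1+\lfloor\frac{(g-\gamma)_3}{2}\rfloor$ and let ${\rm T}$ be a $(3,\gamma)$-hyperelliptic numerical semigroup of genus $g$ for which ${\rm T}_{(u_1)_3}=(u_1+3\mathbb{N})\cap[2g]$. Let ${\rm S}$ be any $(3,\gamma)$-hyperelliptic numerical semigroup of genus $g$ with ${\rm S}_0={\rm T}_0$, and let $u_1'=u_1({\rm S})$. If $\#{\rm S}_{(u_1')_3}<\#{\rm T}_{(u_1)_3}$, then $\widetilde{I}_{\rm T}<\widetilde{I}_{\rm S}$.
   Context: $\mathbb{N}=\{0,1,2,\dots\}$. A numerical semigroup is a subset ${\rm S}\subseteq\mathbb{N}$ containing $0$, closed under addition, with finite complement; its genus is $\#(\mathbb{N}\setminus{\rm S})$. For integers $N,\gamma\ge 0$, ${\rm S}$ is $(N,\gamma)$-hyperelliptic if (1) its first $\gamma$ positive elements $n_1<\dots<n_\gamma$ are multiples of $N$ and $n_\gamma=2\gamma N$, and (2) $(2\gamma+1)N\in{\rm S}$. $(x)_M$ denotes the residue of $x$ modulo $M$ in $\{0,\dots,M-1\}$; $[m]=\{1,\dots,m\}$. For a numerical semigroup ${\rm S}$ of genus $g$: ${\rm S}_i=\{s\in{\rm S}\cap[2g]: (s)_3=i\}$ for $i=0,1,2$; $u_1({\rm S})=\min\{s\in{\rm S}: (s)_3\neq 0\}$; and the inflection is $\widetilde{I}_{\rm S}=\sum_{s\in{\rm S}\cap[2g]}s$.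 -}

module Defs where

open import Data.Nat using (ℕ; zero; suc; _+_; _*_; _∸_; _≤_; _<_; _≡ᵇ_)
open import Data.Nat.DivMod using (_%_; _/_)
open import Data.Nat.Divisibility using (_∣_)
open import Data.Bool using (Bool; true; false; _∧_; not; if_then_else_)
open import Data.Product using (Σ; _×_; ∃-syntax)
open import Relation.Binary.PropositionalEquality using (_≡_; _≢_)
open import Function.Bundles using (_⇔_)

-- A subset of ℕ is represented by its (Boolean) characteristic function.
-- (Subsets with finite complement are decidable, so nothing is lost.)
Subset : Set
Subset = ℕ → Bool

_∈S_ : ℕ → Subset → Set
n ∈S S = S n ≡ true

-- number of n ∈ [m] = {1,…,m} with p n = true
count : (ℕ → Bool) → ℕ → ℕ
count p zero    = 0
count p (suc m) = count p m + (if p (suc m) then 1 else 0)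

count₀ : (ℕ → Bool) → ℕ → ℕ
count₀ p zero    = 0
count₀ p (suc m) = count₀ p m + (if p m then 1 else 0)

sumOver : (ℕ → Bool) → ℕ → ℕ
sumOver p zero    = 0
sumOver p (suc m) = sumOver p m + (if p (suc m) then suc m else 0)

record IsNumericalSemigroup (S : Subset) : Set where
  field
    has-zero   : 0 ∈S S
    closed     : ∀ a b → a ∈S S → b ∈S S → (a + b) ∈S S
    cofinite   : Σ ℕ λ c → ∀ n → c ≤ n → n ∈S S

-- genus = #(ℕ ∖ S): for some c beyond which everything lies in S,
-- the number of gaps in {0,…,c-1} is g.
HasGenus : Subset → ℕ → Set
HasGenus S g = Σ ℕ λ c → (∀ n → c ≤ n → n ∈S S) × (count₀ (λ n → not (S n)) c ≡ g)

-- (N,γ)-hyperelliptic: the first γ positive elements n₁<…<n_γ are multiples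
-- of N with n_γ = 2γN, and (2γ+1)N ∈ S.  Equivalently (literal unfolding):
-- S ∩ [2γN] has exactly γ elements, all multiples of N, and 2γN ∈ S when γ ≥ 1.
record IsHyperelliptic (N γ : ℕ) (S : Subset) : Set where
  field
    count-first : count S (2 * γ * N) ≡ γ
    multiples   : ∀ s → 1 ≤ s → s ≤ 2 * γ * N → s ∈S S → N ∣ s
    last-elem   : 1 ≤ γ → (2 * γ * N) ∈S S
    next-elem   : ((2 * γ + 1) * N) ∈S S

-- characteristic function of S_i = { s ∈ S ∩ [2g] : (s)_3 = i } (restricted to [2g] by the counting range)
resClass : Subset → ℕ → Subset
resClass S i s = S s ∧ (s % 3 ≡ᵇ i)

card : Subset → ℕ → ℕ → ℕ
card S g i = count (resClass S i) (2 * g)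

SameClass : Subset → Subset → ℕ → ℕ → Set
SameClass S T g i = ∀ s → 1 ≤ s → s ≤ 2 * g → s % 3 ≡ i → S s ≡ T s

ClassIsProgression : Subset → ℕ → ℕ → Set
ClassIsProgression T g u =
  ∀ s → 1 ≤ s → s ≤ 2 * g → s % 3 ≡ u % 3 → (s ∈S T ⇔ (∃[ k ] s ≡ u + 3 * k))

IsU₁ : Subset → ℕ → Set
IsU₁ S u = (u ∈S S) × (u % 3 ≢ 0) × (∀ s → s < u → s ∈S S → s % 3 ≡ 0)

inflection : Subset → ℕ → ℕ
inflection S g = sumOver S (2 * g)

u₁formula : ℕ → ℕ → ℕ
u₁formula g γ = g ∸ γ + 1 + ((g ∸ γ) % 3) / 2

module Submission where

-- A semigroup X of genus g contains every n ≥ 2g, so Ĩ_X plus the sum of the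
-- gaps of X is 1 + ⋯ + 2g.  Splitting [3g] into the residue classes c + 3q
-- (c = 1, 2, 3; q < g), the gap sum and the sizes #X_c are read off the gaps of
-- each class.  Class 0 is shared by S and T, so it suffices to compare the gap
-- sums of the classes 1 and 2.  A class with m gaps has gap sum at least lowSum,
-- the sum of its m smallest members; this bound is used for T.  In S the
-- elements 6γ and 6γ + 3 generate every 3m with m ≥ M = (2γ)², so each class
-- fills up M steps after its first member and its gap sum exceeds lowSum by at
-- most E = 3M².  The hypotheses give the sparse class of S more gaps than the
-- sparse class of T, yet, for g ≥ 36M² + 12M + 8, at least 2E + 1 fewer than the
-- dense class of T; by the convexity of lowSum (an exchange identity) the
-- minimal gap sum of S is then smaller than that of T by more than 2E.

open import Defs
open import Data.Nat using (ℕ; zero; suc; _+_; _*_; _∸_; _≤_; _<_; z≤n; s≤s; _≡ᵇ_; _<?_; _≤?_)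
open import Data.Nat.Properties
open import Data.Nat.DivMod using (_%_; _/_; m≡m%n+[m/n]*n; [m+kn]%n≡m%n; m%n<n; m<n⇒m%n≡m; %-distribˡ-+)
open import Data.Nat.Tactic.RingSolver using (solve-∀)
open import Data.Bool using (Bool; true; false; _∧_; not; if_then_else_)
open import Data.Bool.Properties using (∧-zeroʳ)
open import Data.Product using (Σ; _×_; _,_; proj₁; proj₂; ∃-syntax)
open import Data.Sum using (_⊎_; inj₁; inj₂)
open import Data.Empty using (⊥-elim)
open import Relation.Nullary using (yes; no)
open import Relation.Binary.PropositionalEquality hiding (J)
open import Function using (_∘_)
open import Function.Bundles using (Equivalence)
open import Algebra.Properties.CommutativeSemigroup +-commutativeSemigroup using (interchange; x∙yz≈xz∙y; xy∙z≈xz∙y)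

sumBelow : (ℕ → ℕ) → ℕ → ℕ
sumBelow f zero    = 0
sumBelow f (suc n) = sumBelow f n + f n

sumBelow-cong : ∀ {f h} n → (∀ i → i < n → f i ≡ h i) → sumBelow f n ≡ sumBelow h n
sumBelow-cong zero    eq = refl
sumBelow-cong (suc n) eq = cong₂ _+_ (sumBelow-cong n (λ i i<n → eq i (m<n⇒m<1+n i<n))) (eq n (n<1+n n))

sumBelow-+ : ∀ f h n → sumBelow (λ i → f i + h i) n ≡ sumBelow f n + sumBelow h n
sumBelow-+ f h zero    = refl
sumBelow-+ f h (suc n) =
  trans (cong (_+ (f n + h n)) (sumBelow-+ f h n)) (interchange (sumBelow f n) (sumBelow h n) (f n) (h n))

sumBelow-zero : ∀ n → sumBelow (λ _ → 0) n ≡ 0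
sumBelow-zero zero    = refl
sumBelow-zero (suc n) = trans (+-identityʳ _) (sumBelow-zero n)

sumBelow-split : ∀ f m k → sumBelow f (m + k) ≡ sumBelow f m + sumBelow (λ i → f (m + i)) k
sumBelow-split f m zero    = trans (cong (sumBelow f) (+-identityʳ m)) (sym (+-identityʳ _))
sumBelow-split f m (suc k) = begin
  sumBelow f (m + suc k)                                  ≡⟨ cong (sumBelow f) (+-suc m k) ⟩
  sumBelow f (m + k) + f (m + k)                          ≡⟨ cong (_+ f (m + k)) (sumBelow-split f m k) ⟩
  (sumBelow f m + sumBelow (λ i → f (m + i)) k) + f (m + k) ≡⟨ +-assoc (sumBelow f m) _ _ ⟩
  sumBelow f m + sumBelow (λ i → f (m + i)) (suc k)       ∎
  where open ≡-Reasoning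

sumBelow-pad : ∀ f m k → (∀ i → i < k → f (m + i) ≡ 0) → sumBelow f (m + k) ≡ sumBelow f m
sumBelow-pad f m k zeros = begin
  sumBelow f (m + k)                            ≡⟨ sumBelow-split f m k ⟩
  sumBelow f m + sumBelow (λ i → f (m + i)) k   ≡⟨ cong (sumBelow f m +_) (trans (sumBelow-cong k zeros) (sumBelow-zero k)) ⟩
  sumBelow f m + 0                              ≡⟨ +-identityʳ _ ⟩
  sumBelow f m                                  ∎
  where open ≡-Reasoning

sumBelow-prefix : ∀ f {m n} → m ≤ n → sumBelow f m ≤ sumBelow f n
sumBelow-prefix f {m} {n} m≤n = begin
  sumBelow f m                                        ≤⟨ m≤m+n _ _ ⟩
  sumBelow f m + sumBelow (λ i → f (m + i)) (n ∸ m)   ≡⟨ sym (sumBelow-split f m (n ∸ m)) ⟩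
  sumBelow f (m + (n ∸ m))                            ≡⟨ cong (sumBelow f) (m+[n∸m]≡n m≤n) ⟩
  sumBelow f n                                        ∎
  where open ≤-Reasoning

block3 : (ℕ → ℕ) → ℕ → ℕ
block3 f q = f (3 * q) + f (1 + 3 * q) + f (2 + 3 * q)

sumBelow-blocks : ∀ f Q → sumBelow f (3 * Q) ≡ sumBelow (block3 f) Q
sumBelow-blocks f zero    = refl
sumBelow-blocks f (suc Q) = begin
  sumBelow f (3 * suc Q)                                       ≡⟨ cong (sumBelow f) (*-suc 3 Q) ⟩
  sumBelow f (3 * Q) + f (3 * Q) + f (1 + 3 * Q) + f (2 + 3 * Q) ≡⟨ regroup (sumBelow f (3 * Q)) _ _ _ ⟩
  sumBelow f (3 * Q) + block3 f Q                               ≡⟨ cong (_+ block3 f Q) (sumBelow-blocks f Q) ⟩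
  sumBelow (block3 f) Q + block3 f Q                            ∎
  where
  open ≡-Reasoning
  regroup : ∀ x a b c → x + a + b + c ≡ x + (a + b + c)
  regroup = solve-∀


ind : Bool → ℕ
ind b = if b then 1 else 0

count-as-sum : ∀ p m → count p m ≡ sumBelow (λ i → ind (p (suc i))) m
count-as-sum p zero    = refl
count-as-sum p (suc m) = cong (_+ ind (p (suc m))) (count-as-sum p m)

count₀-as-sum : ∀ p m → count₀ p m ≡ sumBelow (λ i → ind (p i)) m
count₀-as-sum p zero    = refl
count₀-as-sum p (suc m) = cong (_+ ind (p m)) (count₀-as-sum p m)

sumOver-as-sum : ∀ p m → sumOver p m ≡ sumBelow (λ i → if p (suc i) then suc i else 0) m
sumOver-as-sum p zero    = refl
sumOver-as-sum p (suc m) = cong (_+ (if p (suc m) then suc m else 0)) (sumOver-as-sum p m)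

ind-not : ∀ b → ind (not b) ≡ (if b then 0 else 1)
ind-not true  = refl
ind-not false = refl

weight-partition : ∀ b x → (if b then x else 0) + (if b then 0 else x) ≡ x
weight-partition true  x = +-identityʳ x
weight-partition false x = refl

count-partition : ∀ (p m : ℕ → Bool) L → count (λ n → p n ∧ m n) L + count (λ n → not (p n) ∧ m n) L ≡ count m L
count-partition p m zero    = refl
count-partition p m (suc L) =
  trans (interchange (count pm L) (ind (pm (suc L))) (count qm L) (ind (qm (suc L))))
        (cong₂ _+_ (count-partition p m L) (split (p (suc L)) (m (suc L))))
  where
  pm qm : ℕ → Bool
  pm n = p n ∧ m n
  qm n = not (p n) ∧ m n
  split : ∀ a b → ind (a ∧ b) + ind (not a ∧ b) ≡ ind b
  split true  b = +-identityʳ (ind b)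
  split false b = refl

mod3 : ∀ r q → r < 3 → (r + 3 * q) % 3 ≡ r
mod3 r q r<3 = trans (cong (λ z → (r + z) % 3) (*-comm 3 q)) (trans ([m+kn]%n≡m%n r q 3) (m<n⇒m%n≡m r<3))

mod3-zero : ∀ q → (3 + 3 * q) % 3 ≡ 0
mod3-zero q = trans (cong (_% 3) (sym (*-suc 3 q))) (mod3 0 (suc q) (s≤s z≤n))

-- A sum over [2g] of terms vanishing beyond 2g, regrouped along the residue
-- classes c + 3q (c = 1, 2, 3; q < g) which cover [3g].
sum-by-residue : ∀ (h : ℕ → ℕ) g → (∀ n → 2 * g < n → h n ≡ 0) →
  sumBelow (λ i → h (suc i)) (2 * g) ≡
  sumBelow (λ q → h (1 + 3 * q)) g + sumBelow (λ q → h (2 + 3 * q)) g + sumBelow (λ q → h (3 + 3 * q)) g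
sum-by-residue h g vanish = begin
  sumBelow h⁺ (2 * g)                                              ≡⟨ sumBelow-pad h⁺ (2 * g) g (λ i _ → vanish _ (s≤s (m≤m+n _ i))) ⟨
  sumBelow h⁺ (2 * g + g)                                          ≡⟨ cong (sumBelow h⁺) (three g) ⟩
  sumBelow h⁺ (3 * g)                                              ≡⟨ sumBelow-blocks h⁺ g ⟩
  sumBelow (λ q → h (1 + 3 * q) + h (2 + 3 * q) + h (3 + 3 * q)) g ≡⟨ sumBelow-+ (λ q → h (1 + 3 * q) + h (2 + 3 * q)) (part 3) g ⟩
  sumBelow (λ q → h (1 + 3 * q) + h (2 + 3 * q)) g + Σ-part 3      ≡⟨ cong (_+ Σ-part 3) (sumBelow-+ (part 1) (part 2) g) ⟩
  Σ-part 1 + Σ-part 2 + Σ-part 3                                   ∎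
  where
  open ≡-Reasoning
  h⁺ : ℕ → ℕ
  h⁺ i = h (suc i)
  part : ℕ → ℕ → ℕ
  part c q = h (c + 3 * q)
  Σ-part : ℕ → ℕ
  Σ-part c = sumBelow (part c) g
  three : ∀ g → 2 * g + g ≡ 3 * g
  three = solve-∀

classSize : ℕ → ℕ → ℕ
classSize c L = count (λ n → n % 3 ≡ᵇ c) L

residue-step : ∀ n → ind (n % 3 ≡ᵇ 1) ≡ ind (suc n % 3 ≡ᵇ 2)
residue-step n rewrite %-distribˡ-+ 1 n 3 ⦃ _ ⦄ with n % 3 | m%n<n n 3
... | 0 | _ = refl
... | 1 | _ = refl
... | 2 | _ = refl
... | suc (suc (suc _)) | s≤s (s≤s (s≤s ()))

-- Up to L the classes 1 and 2 alternate, class 1 first.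
classSize-balance : ∀ L → classSize 1 L ≡ classSize 2 L + ind (L % 3 ≡ᵇ 1)
classSize-balance zero    = refl
classSize-balance (suc L) = begin
  classSize 1 L + ind (suc L % 3 ≡ᵇ 1)                            ≡⟨ cong (_+ ind (suc L % 3 ≡ᵇ 1)) (classSize-balance L) ⟩
  classSize 2 L + ind (L % 3 ≡ᵇ 1) + ind (suc L % 3 ≡ᵇ 1)         ≡⟨ cong (λ x → classSize 2 L + x + ind (suc L % 3 ≡ᵇ 1)) (residue-step L) ⟩
  classSize 2 L + ind (suc L % 3 ≡ᵇ 2) + ind (suc L % 3 ≡ᵇ 1)     ∎
  where open ≡-Reasoning

ind≤1 : ∀ b → ind b ≤ 1
ind≤1 true  = ≤-refl
ind≤1 false = z≤n

classSize-2≤1 : ∀ L → classSize 2 L ≤ classSize 1 L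
classSize-2≤1 L = subst (classSize 2 L ≤_) (sym (classSize-balance L)) (m≤m+n _ _)

classSize-1≤2+1 : ∀ L → classSize 1 L ≤ classSize 2 L + 1
classSize-1≤2+1 L = subst (_≤ classSize 2 L + 1) (sym (classSize-balance L)) (+-monoʳ-≤ _ (ind≤1 _))


module Semigroup {X : Subset} (semX : IsNumericalSemigroup X) where
  open IsNumericalSemigroup semX

  gap : ℕ → Bool
  gap n = not (X n)

  gap-pair : ∀ k j → X (k + j) ≡ false → 1 ≤ ind (gap k) + ind (gap j)
  gap-pair k j k+j∉X with X k in k∈X | X j in j∈X
  ... | false | _    = s≤s z≤n
  ... | true  | false = ≤-refl
  ... | true  | true  with () ← trans (sym k+j∉X) (closed k j k∈X j∈X)

  -- For a gap F the pairs (i, F − i) each contain a gap.  Summed over i < k,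
  -- with j = F + 1 − k:  k + #gaps[0,j) ≤ #gaps[0,k) + #gaps[0,F].
  pairing : ∀ F → X F ≡ false → ∀ k j → k + j ≡ suc F →
            k + count₀ gap j ≤ count₀ gap k + count₀ gap (suc F)
  pairing F F∉X zero    j refl = ≤-refl
  pairing F F∉X (suc k) j eq   = begin
    1 + (k + count₀ gap j)                               ≤⟨ +-monoˡ-≤ _ (gap-pair k j (subst (λ n → X n ≡ false) (sym (suc-injective eq)) F∉X)) ⟩
    (ind (gap k) + ind (gap j)) + (k + count₀ gap j)      ≡⟨ regroup (ind (gap k)) (ind (gap j)) k (count₀ gap j) ⟩
    ind (gap k) + (k + count₀ gap (suc j))               ≤⟨ +-monoʳ-≤ (ind (gap k)) (pairing F F∉X k (suc j) (trans (+-suc k j) eq)) ⟩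
    ind (gap k) + (count₀ gap k + count₀ gap (suc F))     ≡⟨ regroup′ (ind (gap k)) (count₀ gap k) (count₀ gap (suc F)) ⟩
    count₀ gap (suc k) + count₀ gap (suc F)               ∎
    where
    open ≤-Reasoning
    regroup : ∀ a b k c → (a + b) + (k + c) ≡ a + (k + (c + b))
    regroup = solve-∀
    regroup′ : ∀ a c N → a + (c + N) ≡ (c + a) + N
    regroup′ = solve-∀

  count₀-mono : ∀ {m n} → m ≤ n → count₀ gap m ≤ count₀ gap n
  count₀-mono {m} {n} m≤n = subst₂ _≤_ (sym (count₀-as-sum gap m)) (sym (count₀-as-sum gap n))
                                    (sumBelow-prefix (λ i → ind (gap i)) m≤n)

  full-above : ∀ {g} → HasGenus X g → ∀ n → 2 * g ≤ n → X n ≡ true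
  full-above {g} (c , full-c , genus) n 2g≤n with X n in n∈X
  ... | true  = refl
  ... | false = ⊥-elim (<⇒≱ n<2g 2g≤n)
    where
    n<c : n < c
    n<c with n <? c
    ... | yes n<c = n<c
    ... | no  n≮c with () ← trans (sym n∈X) (full-c n (≮⇒≥ n≮c))
    gaps≤g : count₀ gap (suc n) ≤ g
    gaps≤g = subst (count₀ gap (suc n) ≤_) genus (count₀-mono n<c)
    n<2g : n < 2 * g
    n<2g = begin
      suc n                                     ≡⟨ +-identityʳ (suc n) ⟨
      suc n + count₀ gap 0                      ≤⟨ pairing n n∈X (suc n) 0 (+-identityʳ (suc n)) ⟩
      count₀ gap (suc n) + count₀ gap (suc n)   ≤⟨ +-mono-≤ gaps≤g (subst (count₀ gap (suc n) ≤_) (sym (+-identityʳ g)) gaps≤g) ⟩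
      2 * g                                     ∎
      where open ≤-Reasoning

  gaps-below : ∀ {g} → HasGenus X g → ∀ m → 2 * g ≤ m → count₀ gap m ≡ g
  gaps-below {g} genusX@(c , full-c , genus) m 2g≤m with ≤-total c m
  ... | inj₁ c≤m = begin
    count₀ gap m                         ≡⟨ cong (count₀ gap) (m+[n∸m]≡n c≤m) ⟨
    count₀ gap (c + (m ∸ c))             ≡⟨ count₀-as-sum gap (c + (m ∸ c)) ⟩
    sumBelow (λ i → ind (gap i)) (c + (m ∸ c)) ≡⟨ sumBelow-pad _ c (m ∸ c) (λ i _ → cong (ind ∘ not) (full-c (c + i) (m≤m+n c i))) ⟩
    sumBelow (λ i → ind (gap i)) c       ≡⟨ count₀-as-sum gap c ⟨
    count₀ gap c                         ≡⟨ genus ⟩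
    g                                    ∎
    where open ≡-Reasoning
  ... | inj₂ m≤c = begin
    count₀ gap m                         ≡⟨ count₀-as-sum gap m ⟩
    sumBelow (λ i → ind (gap i)) m       ≡⟨ sumBelow-pad _ m (c ∸ m) (λ i _ → cong (ind ∘ not) (full-above genusX (m + i) (≤-trans 2g≤m (m≤m+n m i)))) ⟨
    sumBelow (λ i → ind (gap i)) (m + (c ∸ m)) ≡⟨ count₀-as-sum gap (m + (c ∸ m)) ⟨
    count₀ gap (m + (c ∸ m))             ≡⟨ cong (count₀ gap) (m+[n∸m]≡n m≤c) ⟩
    count₀ gap c                         ≡⟨ genus ⟩
    g                                    ∎
    where open ≡-Reasoning

  gaps-in-[2g] : ∀ {g} → HasGenus X g → count gap (2 * g) ≡ g
  gaps-in-[2g] {g} genusX = begin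
    count gap (2 * g)                                     ≡⟨ count-as-sum gap (2 * g) ⟩
    sumBelow (λ i → ind (gap (suc i))) (2 * g)             ≡⟨ cong (λ b → ind (not b) + sumBelow (λ i → ind (gap (suc i))) (2 * g)) has-zero ⟨
    ind (gap 0) + sumBelow (λ i → ind (gap (1 + i))) (2 * g) ≡⟨ sumBelow-split (λ i → ind (gap i)) 1 (2 * g) ⟨
    sumBelow (λ i → ind (gap i)) (suc (2 * g))             ≡⟨ count₀-as-sum gap (suc (2 * g)) ⟨
    count₀ gap (suc (2 * g))                              ≡⟨ gaps-below genusX (suc (2 * g)) (n≤1+n _) ⟩
    g                                                     ∎
    where open ≡-Reasoning

  closed-multiple : ∀ k s → X s ≡ true → X (k * s) ≡ true
  closed-multiple zero    s s∈X = has-zero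
  closed-multiple (suc k) s s∈X = closed s (k * s) s∈X (closed-multiple k s s∈X)

  -- If A·d and (A+1)·d lie in X then so does d·m for every m ≥ A²: writing
  -- m = A² + j + q(A+1) with j ≤ A gives d·m = (A−j)·(A·d) + (j+q)·((A+1)·d).
  consecutive-multiples : ∀ A d → X (A * d) ≡ true → X ((A + 1) * d) ≡ true →
                          ∀ m → A * A ≤ m → X (d * m) ≡ true
  consecutive-multiples A d Ad∈X A+1d∈X m A²≤m
    with m≤n⇒∃[o]m+o≡n A²≤m
  ... | k , refl with m≤n⇒∃[o]m+o≡n (≤-pred (m%n<n k (suc A)))
  ... | t , A≡j+t = subst (λ n → X n ≡ true) (sym decomposition)
                          (closed _ _ (closed-multiple t _ Ad∈X) (closed-multiple (j + q) _ A+1d∈X))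
    where
    j q : ℕ
    j = k % suc A
    q = k / suc A
    identity : ∀ d j t q → d * ((j + t) * (j + t) + (j + q * suc (j + t)))
                           ≡ t * ((j + t) * d) + (j + q) * ((j + t + 1) * d)
    identity = solve-∀
    decomposition : d * (A * A + k) ≡ t * (A * d) + (j + q) * ((A + 1) * d)
    decomposition = begin
      d * (A * A + k)                                 ≡⟨ cong (λ x → d * (A * A + x)) (m≡m%n+[m/n]*n k (suc A)) ⟩
      d * (A * A + (j + q * suc A))                   ≡⟨ subst (λ B → d * (B * B + (j + q * suc B)) ≡ t * (B * d) + (j + q) * ((B + 1) * d))
                                                               A≡j+t (identity d j t q) ⟩
      t * (A * d) + (j + q) * ((A + 1) * d)           ∎
      where open ≡-Reasoning


-- A residue class c + 3ℕ of a semigroup is seen through its index predicate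
-- P q ⇔ c + 3q ∈ X.  Number and sum of its gaps c + 3q with q < Q:
gapCount : (ℕ → Bool) → ℕ → ℕ
gapCount P Q = sumBelow (λ q → if P q then 0 else 1) Q

gapSum : ℕ → (ℕ → Bool) → ℕ → ℕ
gapSum c P Q = sumBelow (λ q → if P q then 0 else c + 3 * q) Q

lowSum : ℕ → ℕ → ℕ
lowSum c m = sumBelow (λ q → c + 3 * q) m

sumBelow-snoc : ∀ f m → sumBelow f (m + 1) ≡ sumBelow f m + f m
sumBelow-snoc f m = cong (sumBelow f) (+-comm m 1)

gapCount-≤ : ∀ P Q → gapCount P Q ≤ Q
gapCount-≤ P zero = z≤n
gapCount-≤ P (suc Q) with P Q
... | true  = subst (_≤ suc Q) (sym (+-identityʳ _)) (m≤n⇒m≤1+n (gapCount-≤ P Q))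
... | false = subst (_≤ suc Q) (+-comm 1 _) (s≤s (gapCount-≤ P Q))

gapCount-full-from : ∀ P K → (∀ q → K ≤ q → P q ≡ true) → ∀ Q → gapCount P Q ≤ K
gapCount-full-from P K full Q with ≤-total Q K
... | inj₁ Q≤K = ≤-trans (gapCount-≤ P Q) Q≤K
... | inj₂ K≤Q with m≤n⇒∃[o]m+o≡n K≤Q
...   | i , refl = subst (_≤ K) (sym (sumBelow-pad _ K i (λ j _ → cong (λ b → if b then 0 else 1) (full (K + j) (m≤m+n K j)))))
                         (gapCount-≤ P K)

gapCount-initial : ∀ P J → (∀ q → q < J → P q ≡ false) → ∀ Q → Q ≤ J → gapCount P Q ≡ Q
gapCount-initial P J empty zero    _   = refl
gapCount-initial P J empty (suc Q) Q<J rewrite empty Q Q<J =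
  trans (cong (_+ 1) (gapCount-initial P J empty Q (<⇒≤ Q<J))) (+-comm Q 1)

gapCount-past-initial : ∀ P J → (∀ q → q < J → P q ≡ false) → ∀ Q → J ≤ Q → J ≤ gapCount P Q
gapCount-past-initial P J empty Q J≤Q =
  subst (_≤ gapCount P Q) (gapCount-initial P J empty J ≤-refl) (sumBelow-prefix _ J≤Q)

-- The gaps of rank 0, 1, … are at least the members of rank 0, 1, … of the class.
gapSum-lower : ∀ c P Q → lowSum c (gapCount P Q) ≤ gapSum c P Q
gapSum-lower c P zero = z≤n
gapSum-lower c P (suc Q) with P Q
... | true  = subst₂ _≤_ (cong (lowSum c) (sym (+-identityʳ (gapCount P Q)))) (sym (+-identityʳ (gapSum c P Q)))
                     (gapSum-lower c P Q)
... | false = subst (_≤ gapSum c P Q + (c + 3 * Q)) (sym (sumBelow-snoc _ (gapCount P Q)))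
                    (+-mono-≤ (gapSum-lower c P Q) (+-monoʳ-≤ c (*-monoʳ-≤ 3 (gapCount-≤ P Q))))

module DelayedClass (P : ℕ → Bool) (J M : ℕ)
  (empty : ∀ q → q < J → P q ≡ false) (full : ∀ q → J + M ≤ q → P q ≡ true) where

  -- A gap of index Q and rank m = gapCount P Q: below J the index is the rank,
  -- past J (where the rank is ≥ J) the index exceeds the rank by at most M.
  gap-index : ∀ Q → P Q ≡ false →
              Q + M * (gapCount P Q ∸ J) ≤ gapCount P Q + M * ((gapCount P Q + 1) ∸ J)
  gap-index Q Q-gap with Q <? J
  ... | yes Q<J rewrite gapCount-initial P J empty Q (<⇒≤ Q<J) =
    +-monoʳ-≤ Q (*-monoʳ-≤ M (∸-monoˡ-≤ J (m≤m+n Q 1)))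
  ... | no  Q≮J = begin
    Q + M * (m ∸ J)          ≤⟨ +-monoˡ-≤ _ (≤-trans Q≤J+M (+-monoˡ-≤ M J≤m)) ⟩
    (m + M) + M * (m ∸ J)    ≡⟨ regroup m M (m ∸ J) ⟩
    m + M * ((m ∸ J) + 1)    ≡⟨ cong (λ x → m + M * x) (+-∸-comm 1 J≤m) ⟨
    m + M * ((m + 1) ∸ J)    ∎
    where
    open ≤-Reasoning
    m : ℕ
    m = gapCount P Q
    J≤m : J ≤ m
    J≤m = gapCount-past-initial P J empty Q (≮⇒≥ Q≮J)
    Q≤J+M : Q ≤ J + M
    Q≤J+M with Q <? J + M
    ... | yes Q<J+M = <⇒≤ Q<J+M
    ... | no  Q≮J+M with () ← trans (sym Q-gap) (full Q (≮⇒≥ Q≮J+M))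
    regroup : ∀ m M x → (m + M) + M * x ≡ m + M * (x + 1)
    regroup = solve-∀

  -- Gap sum versus its minimum: each gap of rank ≥ J costs at most 3M extra.
  gapSum-excess : ∀ c Q → gapSum c P Q ≤ lowSum c (gapCount P Q) + 3 * M * (gapCount P Q ∸ J)
  gapSum-excess c zero = z≤n
  gapSum-excess c (suc Q) with P Q in Q∈P
  ... | true  = subst₂ (λ s m → s ≤ lowSum c m + 3 * M * (m ∸ J))
                       (sym (+-identityʳ (gapSum c P Q))) (sym (+-identityʳ (gapCount P Q))) (gapSum-excess c Q)
  ... | false = begin
    gapSum c P Q + (c + 3 * Q)                          ≤⟨ +-monoˡ-≤ _ (gapSum-excess c Q) ⟩
    lowSum c m + 3 * M * (m ∸ J) + (c + 3 * Q)          ≡⟨ regroup (lowSum c m) M (m ∸ J) c Q ⟩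
    lowSum c m + (c + 3 * (Q + M * (m ∸ J)))            ≤⟨ +-monoʳ-≤ (lowSum c m) (+-monoʳ-≤ c (*-monoʳ-≤ 3 (gap-index Q Q∈P))) ⟩
    lowSum c m + (c + 3 * (m + M * ((m + 1) ∸ J)))      ≡⟨ regroup′ (lowSum c m) M ((m + 1) ∸ J) c m ⟩
    (lowSum c m + (c + 3 * m)) + 3 * M * ((m + 1) ∸ J)  ≡⟨ cong (_+ 3 * M * ((m + 1) ∸ J)) (sumBelow-snoc _ m) ⟨
    lowSum c (m + 1) + 3 * M * ((m + 1) ∸ J)            ∎
    where
    open ≤-Reasoning
    m : ℕ
    m = gapCount P Q
    regroup : ∀ L M x c Q → L + 3 * M * x + (c + 3 * Q) ≡ L + (c + 3 * (Q + M * x))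
    regroup = solve-∀
    regroup′ : ∀ L M y c m → L + (c + 3 * (m + M * y)) ≡ (L + (c + 3 * m)) + 3 * M * y
    regroup′ = solve-∀

  -- At most M gaps have rank ≥ J, so the excess is at most 3M².
  gapSum-upper : ∀ c Q → gapSum c P Q ≤ lowSum c (gapCount P Q) + 3 * M * M
  gapSum-upper c Q = ≤-trans (gapSum-excess c Q) (+-monoʳ-≤ _ (*-monoʳ-≤ (3 * M) excess≤M))
    where
    excess≤M : gapCount P Q ∸ J ≤ M
    excess≤M = subst (gapCount P Q ∸ J ≤_) (m+n∸m≡n J M) (∸-monoˡ-≤ J (gapCount-full-from P (J + M) full Q))

first-member : ∀ (P : ℕ → Bool) n →
  (∀ q → q < n → P q ≡ false) ⊎ (Σ ℕ λ J → P J ≡ true × (∀ q → q < J → P q ≡ false))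
first-member P zero = inj₁ (λ q ())
first-member P (suc n) with first-member P n
... | inj₂ least = inj₂ least
... | inj₁ none with P n in Pn
...   | true  = inj₂ (n , Pn , none)
...   | false = inj₁ below-suc
  where
  below-suc : ∀ q → q < suc n → P q ≡ false
  below-suc q q<1+n with m≤n⇒m<n∨m≡n (≤-pred q<1+n)
  ... | inj₁ q<n  = none q q<n
  ... | inj₂ refl = Pn

least-index : ∀ P K → P K ≡ true → Σ ℕ λ J → P J ≡ true × (∀ q → q < J → P q ≡ false)
least-index P K PK with first-member P (suc K)
... | inj₂ least = least
... | inj₁ none with () ← trans (sym PK) (none K (n<1+n K))

twice-initial≤ : ∀ P₁ P₂ J z g → (∀ q → q < J → P₁ q ≡ false) → (∀ q → q < J → P₂ q ≡ false) →
                 gapCount P₁ g + gapCount P₂ g + z ≡ g → 1 ≤ g → 2 * J ≤ g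
twice-initial≤ P₁ P₂ J z g empty₁ empty₂ total 1≤g with J ≤? g
... | yes J≤g = begin
  2 * J                                   ≡⟨ cong (J +_) (+-identityʳ J) ⟩
  J + J                                   ≤⟨ +-mono-≤ (gapCount-past-initial P₁ J empty₁ g J≤g) (gapCount-past-initial P₂ J empty₂ g J≤g) ⟩
  gapCount P₁ g + gapCount P₂ g           ≤⟨ m≤m+n _ z ⟩
  gapCount P₁ g + gapCount P₂ g + z       ≡⟨ total ⟩
  g                                       ∎
  where open ≤-Reasoning
... | no  J≰g = ⊥-elim (<-irrefl (sym total) (begin-strict
  g                                       <⟨ m<m+n g 1≤g ⟩
  g + g                                   ≤⟨ m≤m+n (g + g) z ⟩
  g + g + z                               ≡⟨ cong₂ (λ x y → x + y + z) (initial P₁ empty₁) (initial P₂ empty₂) ⟨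
  gapCount P₁ g + gapCount P₂ g + z       ∎))
  where
  open ≤-Reasoning
  initial : ∀ P → (∀ q → q < J → P q ≡ false) → gapCount P g ≡ g
  initial P empty = gapCount-initial P J empty g (<⇒≤ (≰⇒> J≰g))


data Residue : Set where
  one two : Residue

⌜_⌝ : Residue → ℕ
⌜ one ⌝ = 1
⌜ two ⌝ = 2

other : Residue → Residue
other one = two
other two = one

module Classes (X : Subset) (g : ℕ) (full : ∀ n → 2 * g ≤ n → X n ≡ true) where

  cls : ℕ → ℕ → Bool
  cls c q = X (c + 3 * q)

  gaps : ℕ → ℕ
  gaps c = gapCount (cls c) g

  gaps-by-class : ∀ (w : ℕ → ℕ) →
    sumBelow (λ i → if X (suc i) then 0 else w (suc i)) (2 * g) ≡
    sumBelow (λ q → if cls 1 q then 0 else w (1 + 3 * q)) g +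
    sumBelow (λ q → if cls 2 q then 0 else w (2 + 3 * q)) g +
    sumBelow (λ q → if cls 3 q then 0 else w (3 + 3 * q)) g
  gaps-by-class w = sum-by-residue (λ n → if X n then 0 else w n) g vanish
    where
    vanish : ∀ n → 2 * g < n → (if X n then 0 else w n) ≡ 0
    vanish n 2g<n rewrite full n (<⇒≤ 2g<n) = refl

  gaps-total : count (not ∘ X) (2 * g) ≡ g → gaps 1 + gaps 2 + gaps 3 ≡ g
  gaps-total genus = begin
    gaps 1 + gaps 2 + gaps 3                                 ≡⟨ gaps-by-class (λ _ → 1) ⟨
    sumBelow (λ i → if X (suc i) then 0 else 1) (2 * g)      ≡⟨ sumBelow-cong (2 * g) (λ i _ → ind-not (X (suc i))) ⟨
    sumBelow (λ i → ind (not (X (suc i)))) (2 * g)           ≡⟨ count-as-sum (not ∘ X) (2 * g) ⟨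
    count (not ∘ X) (2 * g)                                  ≡⟨ genus ⟩
    g                                                        ∎
    where open ≡-Reasoning

  inflection-complement : inflection X g + (gapSum 1 (cls 1) g + gapSum 2 (cls 2) g + gapSum 3 (cls 3) g)
                          ≡ sumBelow suc (2 * g)
  inflection-complement = begin
    inflection X g + (gapSum 1 (cls 1) g + gapSum 2 (cls 2) g + gapSum 3 (cls 3) g)
      ≡⟨ cong₂ _+_ (sumOver-as-sum X (2 * g)) (sym (gaps-by-class (λ n → n))) ⟩
    sumBelow (λ i → if X (suc i) then suc i else 0) (2 * g) + sumBelow (λ i → if X (suc i) then 0 else suc i) (2 * g)
      ≡⟨ sumBelow-+ (λ i → if X (suc i) then suc i else 0) (λ i → if X (suc i) then 0 else suc i) (2 * g) ⟨
    sumBelow (λ i → (if X (suc i) then suc i else 0) + (if X (suc i) then 0 else suc i)) (2 * g)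
      ≡⟨ sumBelow-cong (2 * g) (λ i _ → weight-partition (X (suc i)) (suc i)) ⟩
    sumBelow suc (2 * g) ∎
    where open ≡-Reasoning

  on-class : ℕ → ℕ → ℕ
  on-class k c = sumBelow (λ q → ind (not (cls c q) ∧ ((c + 3 * q) % 3 ≡ᵇ k))) g

  on-own-class : ∀ k c → (∀ q → ((c + 3 * q) % 3 ≡ᵇ k) ≡ true) → on-class k c ≡ gaps c
  on-own-class k c own = sumBelow-cong g (λ q _ → mask (cls c q) (own q))
    where
    mask : ∀ x {b} → b ≡ true → ind (not x ∧ b) ≡ (if x then 0 else 1)
    mask true  refl = refl
    mask false refl = refl

  on-other-class : ∀ k c → (∀ q → ((c + 3 * q) % 3 ≡ᵇ k) ≡ false) → on-class k c ≡ 0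
  on-other-class k c foreign = trans (sumBelow-cong g (λ q _ → cong ind (trans (cong (not (cls c q) ∧_) (foreign q)) (∧-zeroʳ _))))
                                     (sumBelow-zero g)

  class-gaps : ∀ r → count (λ n → not (X n) ∧ (n % 3 ≡ᵇ ⌜ r ⌝)) (2 * g) ≡ gaps ⌜ r ⌝
  class-gaps r = begin
    count h (2 * g)                                        ≡⟨ count-as-sum h (2 * g) ⟩
    sumBelow (λ i → ind (h (suc i))) (2 * g)               ≡⟨ sum-by-residue (ind ∘ h) g vanish ⟩
    on-class ⌜ r ⌝ 1 + on-class ⌜ r ⌝ 2 + on-class ⌜ r ⌝ 3   ≡⟨ select r ⟩
    gaps ⌜ r ⌝                                             ∎
    where
    open ≡-Reasoning
    h : ℕ → Bool
    h n = not (X n) ∧ (n % 3 ≡ᵇ ⌜ r ⌝)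
    vanish : ∀ n → 2 * g < n → ind (h n) ≡ 0
    vanish n 2g<n rewrite full n (<⇒≤ 2g<n) = refl
    residue : ∀ c k → c < 3 → ∀ q → ((c + 3 * q) % 3 ≡ᵇ k) ≡ (c ≡ᵇ k)
    residue c k c<3 q = cong (_≡ᵇ k) (mod3 c q c<3)
    residue₀ : ∀ k q → ((3 + 3 * q) % 3 ≡ᵇ k) ≡ (0 ≡ᵇ k)
    residue₀ k q = cong (_≡ᵇ k) (mod3-zero q)
    select : ∀ r → on-class ⌜ r ⌝ 1 + on-class ⌜ r ⌝ 2 + on-class ⌜ r ⌝ 3 ≡ gaps ⌜ r ⌝
    select one = trans (cong₂ _+_ (cong₂ _+_ (on-own-class 1 1 (residue 1 1 (s≤s (s≤s z≤n))))
                                            (on-other-class 1 2 (residue 2 1 (s≤s (s≤s (s≤s z≤n))))))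
                                  (on-other-class 1 3 (residue₀ 1)))
                       (trans (+-identityʳ _) (+-identityʳ _))
    select two = trans (cong₂ _+_ (cong₂ _+_ (on-other-class 2 1 (residue 1 2 (s≤s (s≤s z≤n))))
                                            (on-own-class 2 2 (residue 2 2 (s≤s (s≤s (s≤s z≤n))))))
                                  (on-other-class 2 3 (residue₀ 2)))
                       (+-identityʳ _)

  card-complement : ∀ r → card X g ⌜ r ⌝ + gaps ⌜ r ⌝ ≡ classSize ⌜ r ⌝ (2 * g)
  card-complement r = trans (cong (card X g ⌜ r ⌝ +_) (sym (class-gaps r)))
                            (count-partition X (λ n → n % 3 ≡ᵇ ⌜ r ⌝) (2 * g))


-- lowSum c (x + y): the first x members, then y members shifted by 3x.
lowSum-split : ∀ c x y → lowSum c (x + y) ≡ lowSum c x + lowSum c y + 3 * y * x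
lowSum-split c x zero = trans (cong (lowSum c) (+-identityʳ x)) (sym (trans (+-identityʳ _) (+-identityʳ _)))
lowSum-split c x (suc y) = begin
  lowSum c (x + suc y)                                          ≡⟨ cong (lowSum c) (+-suc x y) ⟩
  lowSum c (x + y) + (c + 3 * (x + y))                          ≡⟨ cong (_+ (c + 3 * (x + y))) (lowSum-split c x y) ⟩
  lowSum c x + lowSum c y + 3 * y * x + (c + 3 * (x + y))       ≡⟨ regroup (lowSum c x) (lowSum c y) c x y ⟩
  lowSum c x + (lowSum c y + (c + 3 * y)) + 3 * suc y * x       ∎
  where
  open ≡-Reasoning
  regroup : ∀ L L′ c x y → L + L′ + 3 * y * x + (c + 3 * (x + y)) ≡ L + (L′ + (c + 3 * y)) + 3 * suc y * x
  regroup = solve-∀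

-- The class 2 + 3ℕ is the class 1 + 3ℕ shifted by one.
lowSum-shift : ∀ m → lowSum 2 m ≡ lowSum 1 m + m
lowSum-shift zero    = refl
lowSum-shift (suc m) = trans (cong (_+ (2 + 3 * m)) (lowSum-shift m)) (regroup (lowSum 1 m) m)
  where
  regroup : ∀ L m → L + m + (2 + 3 * m) ≡ L + (1 + 3 * m) + suc m
  regroup = solve-∀

-- Exchange identity (convexity of lowSum): moving d members from a class
-- with b + d gaps to one with a gaps changes the total by 3d(b − a).
lowSum-exchange : ∀ c a b d → lowSum c a + lowSum c (b + d) + 3 * d * a ≡ lowSum c (a + d) + lowSum c b + 3 * d * b
lowSum-exchange c a b d = begin
  lowSum c a + lowSum c (b + d) + 3 * d * a                             ≡⟨ cong (λ x → lowSum c a + x + 3 * d * a) (lowSum-split c b d) ⟩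
  lowSum c a + (lowSum c b + lowSum c d + 3 * d * b) + 3 * d * a         ≡⟨ regroup (lowSum c a) (lowSum c b) (lowSum c d) (3 * d * a) (3 * d * b) ⟩
  lowSum c a + lowSum c d + 3 * d * a + lowSum c b + 3 * d * b           ≡⟨ cong (λ x → x + lowSum c b + 3 * d * b) (lowSum-split c a d) ⟨
  lowSum c (a + d) + lowSum c b + 3 * d * b                             ∎
  where
  open ≡-Reasoning
  regroup : ∀ A B D u v → A + (B + D + v) + u ≡ A + D + u + B + v
  regroup = solve-∀

pairSum : Residue → ℕ → ℕ → ℕ
pairSum r x y = lowSum ⌜ r ⌝ x + lowSum ⌜ other r ⌝ y

-- Its part linear in the gap numbers: the gaps of class 2 are shifted by one.
shift : Residue → ℕ → ℕ → ℕ
shift one x y = y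
shift two x y = x

pairSum-shift : ∀ r x y → pairSum r x y ≡ lowSum 1 x + lowSum 1 y + shift r x y
pairSum-shift one x y = trans (cong (lowSum 1 x +_) (lowSum-shift y)) (sym (+-assoc (lowSum 1 x) (lowSum 1 y) y))
pairSum-shift two x y = trans (cong (_+ lowSum 1 y) (lowSum-shift x)) (regroup (lowSum 1 x) x (lowSum 1 y))
  where
  regroup : ∀ A x B → A + x + B ≡ A + B + x
  regroup = solve-∀

-- By the exchange identity, comparing the minimal sums of the profiles
-- (α + d, β′) and (α, β′ + d) reduces to a linear comparison.
exchange-step : ∀ α β′ d Lₛ Lₜ K → Lₛ + K + 3 * d * α < Lₜ + 3 * d * β′ →
  lowSum 1 (α + d) + lowSum 1 β′ + Lₛ + K < lowSum 1 α + lowSum 1 (β′ + d) + Lₜ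
exchange-step α β′ d Lₛ Lₜ K linear = +-cancelʳ-≤ (3 * d * α) _ _ (begin
  suc (A′ + B′ + Lₛ + K) + 3 * d * α    ≡⟨ regroup A′ B′ Lₛ K (3 * d * α) ⟩
  A′ + B′ + suc (Lₛ + K + 3 * d * α)    ≤⟨ +-monoʳ-≤ (A′ + B′) linear ⟩
  A′ + B′ + (Lₜ + 3 * d * β′)           ≡⟨ regroup′ A′ B′ Lₜ (3 * d * β′) ⟩
  A′ + B′ + 3 * d * β′ + Lₜ             ≡⟨ cong (_+ Lₜ) (lowSum-exchange 1 α β′ d) ⟨
  A + B + 3 * d * α + Lₜ                ≡⟨ regroup″ A B (3 * d * α) Lₜ ⟩
  A + B + Lₜ + 3 * d * α                ∎)
  where
  open ≤-Reasoning
  A B A′ B′ : ℕ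
  A = lowSum 1 α
  B = lowSum 1 (β′ + d)
  A′ = lowSum 1 (α + d)
  B′ = lowSum 1 β′
  regroup : ∀ A B L K u → suc (A + B + L + K) + u ≡ A + B + suc (L + K + u)
  regroup = solve-∀
  regroup′ : ∀ A B L v → A + B + (L + v) ≡ A + B + v + L
  regroup′ = solve-∀
  regroup″ : ∀ A B u L → A + B + u + L ≡ A + B + L + u
  regroup″ = solve-∀

<-by : ∀ {m n} k → n ≡ suc (m + k) → m < n
<-by {m} k refl = s≤s (m≤m+n m k)

≤-by : ∀ {m n} k → n ≡ m + k → m ≤ n
≤-by {m} k refl = m≤m+n m k

-- #{n ∈ [L] : n ≡ r} ≤ #{n ∈ [L] : n ≡ a} + slack a r: only class 1 can be
-- the larger one, and by one element at most.
slack : Residue → Residue → ℕ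
slack two one = 1
slack _   _   = 0

slack≤1 : ∀ a r → slack a r ≤ 1
slack≤1 one one = z≤n
slack≤1 one two = z≤n
slack≤1 two one = ≤-refl
slack≤1 two two = z≤n

classSize-slack : ∀ a r L → classSize ⌜ r ⌝ L ≤ classSize ⌜ a ⌝ L + slack a r
classSize-slack one one L = m≤m+n _ 0
classSize-slack one two L = ≤-trans (classSize-2≤1 L) (m≤m+n _ 0)
classSize-slack two one L = classSize-1≤2+1 L
classSize-slack two two L = m≤m+n _ 0

-- The linear inequality left after the exchange identity, for a sparse class of
-- T with α gaps, d more gaps in the sparse class of S, and β′ = α + 2E + 1 + D.
LinearGain : Residue → Residue → ℕ → ℕ → ℕ → ℕ → Set
LinearGain a r α d D E = shift a (α + d) β′ + 2 * E + 3 * d * α < shift r α (β′ + d) + 3 * d * β′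
  where
  β′ : ℕ
  β′ = α + (2 * E + 1) + D

gain-one-one : ∀ α d D E → LinearGain one one α (suc d) D E
gain-one-one α d D E = <-by (d + 4 * E + 3 + 3 * D + 3 * d * (2 * E + 1 + D)) (identity α d D E)
  where
  identity : ∀ α d D E → α + (2 * E + 1) + D + suc d + 3 * suc d * (α + (2 * E + 1) + D)
             ≡ suc (α + (2 * E + 1) + D + 2 * E + 3 * suc d * α + (d + 4 * E + 3 + 3 * D + 3 * d * (2 * E + 1 + D)))
  identity = solve-∀

gain-two-two : ∀ α d D E → LinearGain two two α (suc d) D E
gain-two-two α d D E = <-by (4 * E + 1 + 3 * D + d * (6 * E + 2 + 3 * D)) (identity α d D E)
  where
  identity : ∀ α d D E → α + 3 * suc d * (α + (2 * E + 1) + D)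
             ≡ suc (α + suc d + 2 * E + 3 * suc d * α + (4 * E + 1 + 3 * D + d * (6 * E + 2 + 3 * D)))
  identity = solve-∀

gain-one-two : ∀ α d D E → LinearGain one two α (suc d) D E
gain-one-two α d D E = <-by (2 * E + 1 + 2 * D + 3 * d * (2 * E + 1 + D)) (identity α d D E)
  where
  identity : ∀ α d D E → α + 3 * suc d * (α + (2 * E + 1) + D)
             ≡ suc (α + (2 * E + 1) + D + 2 * E + 3 * suc d * α + (2 * E + 1 + 2 * D + 3 * d * (2 * E + 1 + D)))
  identity = solve-∀

gain-two-one : ∀ α d D E → LinearGain two one α d D E
gain-two-one α d D E = <-by (D + 3 * d * (2 * E + 1 + D)) (identity α d D E)
  where
  identity : ∀ α d D E → α + (2 * E + 1) + D + d + 3 * d * (α + (2 * E + 1) + D)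
             ≡ suc (α + d + 2 * E + 3 * d * α + (D + 3 * d * (2 * E + 1 + D)))
  identity = solve-∀

from-positive : ∀ a r α D E → (∀ d₀ → LinearGain a r α (suc d₀) D E) → ∀ d → 1 ≤ d → LinearGain a r α d D E
from-positive a r α D E gain d 1≤d with m≤n⇒∃[o]m+o≡n 1≤d
... | d₀ , 1+d₀≡d = subst (λ x → LinearGain a r α x D E) 1+d₀≡d (gain d₀)

linear-gain : ∀ a r α d D E → (slack a r ≡ 0 → 1 ≤ d) → LinearGain a r α d D E
linear-gain one one = λ α d D E positive → from-positive one one α D E (λ d₀ → gain-one-one α d₀ D E) d (positive refl)
linear-gain one two = λ α d D E positive → from-positive one two α D E (λ d₀ → gain-one-two α d₀ D E) d (positive refl)
linear-gain two one = λ α d D E _        → gain-two-one α d D E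
linear-gain two two = λ α d D E positive → from-positive two two α D E (λ d₀ → gain-two-two α d₀ D E) d (positive refl)

exchange-core : ∀ a r E α d D → (slack a r ≡ 0 → 1 ≤ d) →
  pairSum a (α + d) (α + (2 * E + 1) + D) + 2 * E < pairSum r α (α + (2 * E + 1) + D + d)
exchange-core a r E α d D positive =
  subst₂ _<_ (sym (cong (_+ 2 * E) (pairSum-shift a (α + d) β′))) (sym (pairSum-shift r α (β′ + d)))
         (exchange-step α β′ d (shift a (α + d) β′) (shift r α (β′ + d)) (2 * E) (linear-gain a r α d D E positive))
  where
  β′ : ℕ
  β′ = α + (2 * E + 1) + D

exchange : ∀ a r E α β α′ β′ → α + 1 ≤ α′ + slack a r → α′ + (2 * E + 1) ≤ β → α′ + β′ ≡ α + β →
           pairSum a α′ β′ + 2 * E < pairSum r α β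
exchange a r E α β α′ β′ more far total
  with m≤n⇒∃[o]m+o≡n (+-cancelʳ-≤ 1 α α′ (≤-trans more (+-monoʳ-≤ α′ (slack≤1 a r))))
... | d , refl with +-cancelˡ-≡ α (β′ + d) β (trans (x∙yz≈xz∙y α β′ d) total)
... | refl with m≤n⇒∃[o]m+o≡n (+-cancelʳ-≤ d (α + (2 * E + 1)) β′ (subst (_≤ β′ + d) (xy∙z≈xz∙y α d (2 * E + 1)) far))
... | D , refl = exchange-core a r E α d D positive
  where
  positive : slack a r ≡ 0 → 1 ≤ d
  positive slack≡0 = +-cancelˡ-≤ α 1 d (≤-trans more (≤-reflexive (trans (cong (α + d +_) slack≡0) (+-identityʳ (α + d)))))

pairSum-profile : ∀ r (x : Residue → ℕ) → pairSum r (x r) (x (other r)) ≡ lowSum 1 (x one) + lowSum 2 (x two)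
pairSum-profile one x = refl
pairSum-profile two x = +-comm (lowSum 2 (x two)) (lowSum 1 (x one))

profile-total : ∀ r (x : Residue → ℕ) → x r + x (other r) ≡ x one + x two
profile-total one x = refl
profile-total two x = +-comm (x two) (x one)

more-gaps : ∀ {cₛ cₜ α′ α Nₛ Nₜ s} → cₛ < cₜ → cₛ + α′ ≡ Nₛ → cₜ + α ≡ Nₜ → Nₜ ≤ Nₛ + s → α + 1 ≤ α′ + s
more-gaps {cₛ} {cₜ} {α′} {α} {Nₛ} {Nₜ} {s} cₛ<cₜ sizeₛ sizeₜ Nₜ≤ = +-cancelˡ-≤ cₜ (α + 1) (α′ + s) (begin
  cₜ + (α + 1)         ≡⟨ trans (cong (cₜ +_) (+-comm α 1)) (+-suc cₜ α) ⟩
  suc (cₜ + α)         ≡⟨ cong suc sizeₜ ⟩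
  suc Nₜ               ≤⟨ s≤s Nₜ≤ ⟩
  suc (Nₛ + s)         ≡⟨ cong (λ N → suc (N + s)) sizeₛ ⟨
  suc (cₛ + α′ + s)    ≡⟨ cong suc (+-assoc cₛ α′ s) ⟩
  suc cₛ + (α′ + s)    ≤⟨ +-monoˡ-≤ (α′ + s) cₛ<cₜ ⟩
  cₜ + (α′ + s)        ∎)
  where open ≤-Reasoning

-- With g ≥ 36M² + 12M + 8, a class of S with at most J′ + M gaps (2J′ ≤ g)
-- lies at least 2E + 1 = 6M² + 1 below the dense class of T, which has all the
-- g gaps except the ≤ J (3J ≤ g + 1) of T's sparse class and ≤ M of class 0.
far-apart : ∀ g M α β z α′ J J′ → α + β + z ≡ g → α ≤ J → z ≤ M → α′ ≤ J′ + M →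
            3 * J ≤ g + 1 → 2 * J′ ≤ g → 36 * M * M + 12 * M + 8 ≤ g → α′ + (2 * (3 * M * M) + 1) ≤ β
far-apart g M α β z α′ J J′ total α≤J z≤M α′≤ 3J≤ 2J′≤ large = *-cancelˡ-≤ 6 (+-cancelʳ-≤ (6 * α + 6 * z) _ _ (begin
  6 * (α′ + K) + (6 * α + 6 * z)                   ≤⟨ +-mono-≤ (*-monoʳ-≤ 6 (+-monoˡ-≤ K α′≤)) (+-mono-≤ (*-monoʳ-≤ 6 α≤J) (*-monoʳ-≤ 6 z≤M)) ⟩
  6 * ((J′ + M) + K) + (6 * J + 6 * M)             ≡⟨ regroup₁ J′ M J ⟩
  3 * (2 * J′) + 2 * (3 * J) + (36 * M * M + 12 * M + 6) ≤⟨ +-monoˡ-≤ _ (+-mono-≤ (*-monoʳ-≤ 3 2J′≤) (*-monoʳ-≤ 2 3J≤)) ⟩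
  3 * g + 2 * (g + 1) + (36 * M * M + 12 * M + 6) ≡⟨ regroup₂ g M ⟩
  5 * g + (36 * M * M + 12 * M + 8)                ≤⟨ +-monoʳ-≤ (5 * g) large ⟩
  5 * g + g                                        ≡⟨ cong (λ n → 5 * n + n) total ⟨
  5 * (α + β + z) + (α + β + z)                    ≡⟨ regroup₃ α β z ⟩
  6 * β + (6 * α + 6 * z)                          ∎))
  where
  open ≤-Reasoning
  K : ℕ
  K = 2 * (3 * M * M) + 1
  regroup₁ : ∀ J′ M J → 6 * ((J′ + M) + (2 * (3 * M * M) + 1)) + (6 * J + 6 * M)
                        ≡ 3 * (2 * J′) + 2 * (3 * J) + (36 * M * M + 12 * M + 6)
  regroup₁ = solve-∀
  regroup₂ : ∀ g M → 3 * g + 2 * (g + 1) + (36 * M * M + 12 * M + 6) ≡ 5 * g + (36 * M * M + 12 * M + 8)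
  regroup₂ = solve-∀
  regroup₃ : ∀ α β z → 5 * (α + β + z) + (α + β + z) ≡ 6 * β + (6 * α + 6 * z)
  regroup₃ = solve-∀


decompose3 : ∀ n → n ≡ n % 3 + 3 * (n / 3)
decompose3 n = trans (m≡m%n+[m/n]*n n 3) (cong (n % 3 +_) (*-comm (n / 3) 3))

1≤⌜⌝ : ∀ r → 1 ≤ ⌜ r ⌝
1≤⌜⌝ one = s≤s z≤n
1≤⌜⌝ two = s≤s z≤n

⌜⌝≢0 : ∀ r → ⌜ r ⌝ ≢ 0
⌜⌝≢0 one ()
⌜⌝≢0 two ()

⌜⌝<3 : ∀ r → ⌜ r ⌝ < 3
⌜⌝<3 one = s≤s (s≤s z≤n)
⌜⌝<3 two = s≤s (s≤s (s≤s z≤n))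

residue-of : ∀ r J → (⌜ r ⌝ + 3 * J) % 3 ≡ ⌜ r ⌝
residue-of r J = mod3 ⌜ r ⌝ J (⌜⌝<3 r)

u₁-shape : ∀ h → Σ Residue λ r → Σ ℕ λ J → (h + 1 + (h % 3) / 2 ≡ ⌜ r ⌝ + 3 * J) × (⌜ r ⌝ + 3 * J ≤ h + 2)
u₁-shape h = shape (h % 3) (h / 3) (m%n<n h 3) (decompose3 h)
  where
  shape : ∀ ρ K → ρ < 3 → h ≡ ρ + 3 * K →
          Σ Residue λ r → Σ ℕ λ J → (h + 1 + ρ / 2 ≡ ⌜ r ⌝ + 3 * J) × (⌜ r ⌝ + 3 * J ≤ h + 2)
  shape 0 K _ refl = one , K , identity K , ≤-by 1 (bound K)
    where
    identity : ∀ K → 3 * K + 1 + 0 ≡ 1 + 3 * K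
    identity = solve-∀
    bound : ∀ K → 3 * K + 2 ≡ 1 + 3 * K + 1
    bound = solve-∀
  shape 1 K _ refl = two , K , identity K , ≤-by 1 (bound K)
    where
    identity : ∀ K → 1 + 3 * K + 1 + 0 ≡ 2 + 3 * K
    identity = solve-∀
    bound : ∀ K → 1 + 3 * K + 2 ≡ 2 + 3 * K + 1
    bound = solve-∀
  shape 2 K _ refl = one , suc K , identity K , ≤-by 0 (bound K)
    where
    identity : ∀ K → 2 + 3 * K + 1 + 1 ≡ 1 + 3 * suc K
    identity = solve-∀
    bound : ∀ K → 2 + 3 * K + 2 ≡ 1 + 3 * suc K + 0
    bound = solve-∀
  shape (suc (suc (suc _))) K (s≤s (s≤s (s≤s ()))) _

nonzero-residue : ∀ n → n % 3 ≢ 0 → Σ Residue λ a → n % 3 ≡ ⌜ a ⌝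
nonzero-residue n n≢0 with n % 3 | m%n<n n 3
... | 0 | _ = ⊥-elim (n≢0 refl)
... | 1 | _ = one , refl
... | 2 | _ = two , refl
... | suc (suc (suc _)) | s≤s (s≤s (s≤s ()))

shift-index : ∀ c J q → J ≤ q → c + 3 * J + 3 * (q ∸ J) ≡ c + 3 * q
shift-index c J q J≤q = trans (trans (+-assoc c _ _) (cong (c +_) (sym (*-distribˡ-+ 3 J (q ∸ J)))))
                              (cong (λ k → c + 3 * k) (m+[n∸m]≡n J≤q))

complement-order : ∀ {Iₛ Iₜ Gₛ Gₜ z N} → Iₛ + (Gₛ + z) ≡ N → Iₜ + (Gₜ + z) ≡ N → Gₛ < Gₜ → Iₜ < Iₛ
complement-order {Iₛ} {Iₜ} {Gₛ} {Gₜ} {z} sumₛ sumₜ Gₛ<Gₜ = +-cancelʳ-< (Gₛ + z) Iₜ Iₛ (begin-strict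
  Iₜ + (Gₛ + z)   <⟨ +-monoʳ-< Iₜ (+-monoˡ-< z Gₛ<Gₜ) ⟩
  Iₜ + (Gₜ + z)   ≡⟨ trans sumₜ (sym sumₛ) ⟩
  Iₛ + (Gₛ + z)   ∎)
  where open ≤-Reasoning

-- M = (2γ)²: from M on, every multiple of 3 lies in a (3,γ)-hyperelliptic semigroup.
delay : ℕ → ℕ
delay γ = 2 * γ * (2 * γ)

threshold : ℕ → ℕ
threshold γ = 36 * delay γ * delay γ + 12 * delay γ + 8

module Setting
  (γ g : ℕ) (large : threshold γ ≤ g)
  (T : Subset) (semT : IsNumericalSemigroup T) (genusT : HasGenus T g)
  (progT : ClassIsProgression T g (u₁formula g γ))
  (S : Subset) (semS : IsNumericalSemigroup S) (genusS : HasGenus S g) (hypS : IsHyperelliptic 3 γ S)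
  (same₀ : SameClass S T g 0) (u₁′ : ℕ) (u₁′-least : IsU₁ S u₁′) where

  M E : ℕ
  M = delay γ
  E = 3 * M * M

  module SS = Semigroup semS
  module ST = Semigroup semT
  open IsNumericalSemigroup semS using (has-zero; closed)

  fullS : ∀ n → 2 * g ≤ n → S n ≡ true
  fullS = SS.full-above genusS
  fullT : ∀ n → 2 * g ≤ n → T n ≡ true
  fullT = ST.full-above genusT

  module CS = Classes S g fullS
  module CT = Classes T g fullT

  xS xT : Residue → ℕ
  xS c = CS.gaps ⌜ c ⌝
  xT c = CT.gaps ⌜ c ⌝

  1≤g : 1 ≤ g
  1≤g = ≤-trans (s≤s z≤n) (≤-trans (m≤n+m 8 _) large)

  -- 6γ and 6γ + 3 lie in S, hence all 3m with m ≥ M.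
  threes : ∀ m → M ≤ m → S (3 * m) ≡ true
  threes = SS.consecutive-multiples (2 * γ) 3 (last γ hypS) (IsHyperelliptic.next-elem hypS)
    where
    last : ∀ γ → IsHyperelliptic 3 γ S → S (2 * γ * 3) ≡ true
    last zero    _   = has-zero
    last (suc γ) hyp = IsHyperelliptic.last-elem hyp (s≤s z≤n)

  class-delay : ∀ c J → S (c + 3 * J) ≡ true → ∀ q → J + M ≤ q → S (c + 3 * q) ≡ true
  class-delay c J member q J+M≤q =
    subst (λ n → S n ≡ true) (shift-index c J q (≤-trans (m≤m+n J M) J+M≤q))
          (closed _ _ member (threes (q ∸ J) M≤q∸J))
    where
    M≤q∸J : M ≤ q ∸ J
    M≤q∸J = subst (_≤ q ∸ J) (m+n∸m≡n J M) (∸-monoˡ-≤ J J+M≤q)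

  gapSum-S : ∀ c → gapSum c (CS.cls c) g ≤ lowSum c (CS.gaps c) + E
  gapSum-S c with least-index (CS.cls c) g (fullS (c + 3 * g) (≤-trans (*-monoˡ-≤ g {2} {3} (s≤s (s≤s z≤n))) (m≤n+m (3 * g) c)))
  ... | J , first , empty = DelayedClass.gapSum-upper (CS.cls c) J M empty (class-delay c J first) c g

  -- Class 0 is shared: S₀ = T₀ inside [2g], and both are full beyond.
  same-class₀ : ∀ q → S (3 + 3 * q) ≡ T (3 + 3 * q)
  same-class₀ q with 3 + 3 * q ≤? 2 * g
  ... | yes inside = same₀ (3 + 3 * q) (s≤s z≤n) inside (mod3-zero q)
  ... | no  beyond = trans (fullS _ (<⇒≤ (≰⇒> beyond))) (sym (fullT _ (<⇒≤ (≰⇒> beyond))))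

  gaps₀ : CT.gaps 3 ≡ CS.gaps 3
  gaps₀ = sumBelow-cong g (λ q _ → cong (λ b → if b then 0 else 1) (sym (same-class₀ q)))

  gapSum₀ : gapSum 3 (CT.cls 3) g ≡ gapSum 3 (CS.cls 3) g
  gapSum₀ = sumBelow-cong g (λ q _ → cong (λ b → if b then 0 else 3 + 3 * q) (sym (same-class₀ q)))

  -- 3(q + 1) ∈ S once q ≥ M, so class 0 has at most M gaps.
  gaps₀≤M : CS.gaps 3 ≤ M
  gaps₀≤M = gapCount-full-from (CS.cls 3) M
              (λ q M≤q → subst (λ n → S n ≡ true) (*-suc 3 q) (threes (suc q) (m≤n⇒m≤1+n M≤q))) g

  totalS : xS one + xS two + CS.gaps 3 ≡ g
  totalS = CS.gaps-total (SS.gaps-in-[2g] genusS)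

  totalT : xT one + xT two + CS.gaps 3 ≡ g
  totalT = subst (λ z → xT one + xT two + z ≡ g) gaps₀ (CT.gaps-total (ST.gaps-in-[2g] genusT))

  same-profile : ∀ a r → xS a + xS (other a) ≡ xT r + xT (other r)
  same-profile a r = trans (profile-total a xS)
                           (trans (+-cancelʳ-≡ (CS.gaps 3) _ _ (trans totalS (sym totalT))) (sym (profile-total r xT)))

  r : Residue
  r = proj₁ (u₁-shape (g ∸ γ))
  J : ℕ
  J = proj₁ (proj₂ (u₁-shape (g ∸ γ)))
  u₁≡ : u₁formula g γ ≡ ⌜ r ⌝ + 3 * J
  u₁≡ = proj₁ (proj₂ (proj₂ (u₁-shape (g ∸ γ))))

  u₁-residue : u₁formula g γ % 3 ≡ ⌜ r ⌝
  u₁-residue = trans (cong (_% 3) u₁≡) (residue-of r J)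

  T-progression : ∀ q → J ≤ q → T (⌜ r ⌝ + 3 * q) ≡ true
  T-progression q J≤q with ⌜ r ⌝ + 3 * q ≤? 2 * g
  ... | yes inside = Equivalence.from (progT _ (≤-trans (1≤⌜⌝ r) (m≤m+n _ _)) inside residue) (q ∸ J , position)
    where
    residue : (⌜ r ⌝ + 3 * q) % 3 ≡ u₁formula g γ % 3
    residue = trans (residue-of r q) (sym u₁-residue)
    position : ⌜ r ⌝ + 3 * q ≡ u₁formula g γ + 3 * (q ∸ J)
    position = trans (sym (shift-index ⌜ r ⌝ J q J≤q)) (cong (_+ 3 * (q ∸ J)) (sym u₁≡))
  ... | no  beyond = fullT _ (<⇒≤ (≰⇒> beyond))

  xT-sparse : xT r ≤ J
  xT-sparse = gapCount-full-from (CT.cls ⌜ r ⌝) J T-progression g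

  3J≤g+1 : 3 * J ≤ g + 1
  3J≤g+1 = ≤-pred (begin
    suc (3 * J)        ≤⟨ +-monoˡ-≤ (3 * J) (1≤⌜⌝ r) ⟩
    ⌜ r ⌝ + 3 * J      ≤⟨ proj₂ (proj₂ (proj₂ (u₁-shape (g ∸ γ)))) ⟩
    g ∸ γ + 2          ≤⟨ +-monoˡ-≤ 2 (m∸n≤m g γ) ⟩
    g + 2              ≡⟨ +-suc g 1 ⟩
    suc (g + 1)        ∎)
    where open ≤-Reasoning

  a : Residue
  a = proj₁ (nonzero-residue u₁′ (proj₁ (proj₂ u₁′-least)))
  J′ : ℕ
  J′ = u₁′ / 3
  u₁′-residue : u₁′ % 3 ≡ ⌜ a ⌝
  u₁′-residue = proj₂ (nonzero-residue u₁′ (proj₁ (proj₂ u₁′-least)))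
  u₁′≡ : u₁′ ≡ ⌜ a ⌝ + 3 * J′
  u₁′≡ = trans (decompose3 u₁′) (cong (_+ 3 * J′) u₁′-residue)

  S-empty-below : ∀ c q → q < J′ → S (⌜ c ⌝ + 3 * q) ≡ false
  S-empty-below c q q<J′ with S (⌜ c ⌝ + 3 * q) in member
  ... | false = refl
  ... | true  = ⊥-elim (⌜⌝≢0 c (trans (sym (residue-of c q)) (proj₂ (proj₂ u₁′-least) _ below member)))
    where
    below : ⌜ c ⌝ + 3 * q < u₁′
    below = begin-strict
      ⌜ c ⌝ + 3 * q    <⟨ +-monoˡ-< (3 * q) (⌜⌝<3 c) ⟩
      3 + 3 * q        ≡⟨ *-suc 3 q ⟨
      3 * suc q        ≤⟨ *-monoʳ-≤ 3 q<J′ ⟩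
      3 * J′           ≤⟨ m≤n+m (3 * J′) ⌜ a ⌝ ⟩
      ⌜ a ⌝ + 3 * J′   ≡⟨ u₁′≡ ⟨
      u₁′              ∎
      where open ≤-Reasoning

  xS-sparse : xS a ≤ J′ + M
  xS-sparse = gapCount-full-from (CS.cls ⌜ a ⌝) (J′ + M)
                (class-delay ⌜ a ⌝ J′ (subst (λ n → S n ≡ true) u₁′≡ (proj₁ u₁′-least))) g

  2J′≤g : 2 * J′ ≤ g
  2J′≤g = twice-initial≤ (CS.cls 1) (CS.cls 2) J′ (CS.gaps 3) g (S-empty-below one) (S-empty-below two) totalS 1≤g

  more-gaps-in-S : card S g (u₁′ % 3) < card T g (u₁formula g γ % 3) → xT r + 1 ≤ xS a + slack a r
  more-gaps-in-S card< = more-gaps (subst₂ (λ i j → card S g i < card T g j) u₁′-residue u₁-residue card<)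
                                   (CS.card-complement a) (CT.card-complement r) (classSize-slack a r (2 * g))

  dense-apart : xS a + (2 * E + 1) ≤ xT (other r)
  dense-apart = far-apart g M (xT r) (xT (other r)) (CS.gaps 3) (xS a) J J′
                  (trans (cong (_+ CS.gaps 3) (profile-total r xT)) totalT)
                  xT-sparse gaps₀≤M xS-sparse 3J≤g+1 2J′≤g large

  gap-sums : pairSum a (xS a) (xS (other a)) + 2 * E < pairSum r (xT r) (xT (other r)) →
             gapSum 1 (CS.cls 1) g + gapSum 2 (CS.cls 2) g < gapSum 1 (CT.cls 1) g + gapSum 2 (CT.cls 2) g
  gap-sums minimal< = begin-strict
    gapSum 1 (CS.cls 1) g + gapSum 2 (CS.cls 2) g        ≤⟨ +-mono-≤ (gapSum-S 1) (gapSum-S 2) ⟩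
    (lowSum 1 (xS one) + E) + (lowSum 2 (xS two) + E)    ≡⟨ regroup (lowSum 1 (xS one)) (lowSum 2 (xS two)) E ⟩
    lowSum 1 (xS one) + lowSum 2 (xS two) + 2 * E        ≡⟨ cong (_+ 2 * E) (pairSum-profile a xS) ⟨
    pairSum a (xS a) (xS (other a)) + 2 * E              <⟨ minimal< ⟩
    pairSum r (xT r) (xT (other r))                      ≡⟨ pairSum-profile r xT ⟩
    lowSum 1 (xT one) + lowSum 2 (xT two)                ≤⟨ +-mono-≤ (gapSum-lower 1 (CT.cls 1) g) (gapSum-lower 2 (CT.cls 2) g) ⟩
    gapSum 1 (CT.cls 1) g + gapSum 2 (CT.cls 2) g        ∎
    where
    open ≤-Reasoning
    regroup : ∀ x y E → (x + E) + (y + E) ≡ x + y + 2 * E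
    regroup = solve-∀

  -- Ĩ + (sum of gaps) = 1 + ⋯ + 2g for both, and class 0 contributes equally.
  inflection-from-gaps : gapSum 1 (CS.cls 1) g + gapSum 2 (CS.cls 2) g < gapSum 1 (CT.cls 1) g + gapSum 2 (CT.cls 2) g →
                         inflection T g < inflection S g
  inflection-from-gaps = complement-order CS.inflection-complement
                           (trans (cong (λ z → inflection T g + (gapSum 1 (CT.cls 1) g + gapSum 2 (CT.cls 2) g + z)) (sym gapSum₀))
                                  CT.inflection-complement)

-- The threshold is g₀ = 36M² + 12M + 8 with M = (2γ)².
proposition2p9 : ∀ (γ : ℕ) → ∃[ g₀ ] ∀ (g : ℕ) → g₀ ≤ g →
    ∀ (T : Subset) → IsNumericalSemigroup T → HasGenus T g → IsHyperelliptic 3 γ T →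
    ClassIsProgression T g (u₁formula g γ) →
    ∀ (S : Subset) → IsNumericalSemigroup S → HasGenus S g → IsHyperelliptic 3 γ S →
    SameClass S T g 0 →
    ∀ (u₁′ : ℕ) → IsU₁ S u₁′ →
    card S g (u₁′ % 3) < card T g (u₁formula g γ % 3) →
    inflection T g < inflection S g
proposition2p9 γ = threshold γ , λ g large T semT genusT _ progT S semS genusS hypS same₀ u₁′ u₁′-least card< →
  let open Setting γ g large T semT genusT progT S semS genusS hypS same₀ u₁′ u₁′-least in
  inflection-from-gaps
    (gap-sums
      (exchange a r E (xT r) (xT (other r)) (xS a) (xS (other a))
                (more-gaps-in-S card<) dense-apart (same-profile a r)))
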